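{- The logic $\mathbf{L}_{\mathrm{QN4}}$ is BP-algebraizable (algebraizable in the sense of Blok and Pigozzi with finite sets of defining equations and equivalence formulas). More precisely, with $E(\alpha):=\{\alpha\approx\alpha\to\alpha\}$ and $\Delta(\alpha,\beta):=\{\alpha\to\beta,\ \beta\to\alpha,\ \sim\alpha\to\sim\beta,\ \sim\beta\to\sim\alpha\}$, the following hold for all formulas: $\vdash\Delta(\alpha,\alpha)$; $\alpha,\Delta(\alpha,\beta)\vdash\beta$ (equivalently, $\Delta(\alpha,\beta)\vdash\Delta(\beta,\alpha)$ and $\Delta(\alpha,\beta)\cup\Delta(\beta,\gamma)\vdash\Delta(\alpha,\gamma)$); $\alpha\dashv\vdash\Delta(\alpha,\alpha\to\alpha)$; and for each connective $\bullet\in\{\sim,\land,\lor,\to\}$ of arity $n$, $\bigcup_{i=1}^n\Delta(\alpha_i,\beta_i)\vdash\Delta(\bullet(\alpha_1,\dots,\alpha_n),\bullet(\beta_1,\dots,\beta_n))$, where $\vdash$ is $\vdash_{\mathbf{L}_{\mathrm{QN4}}}$.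
   Context: Formulas are built from a denumerable set of propositional variables using the unary connective $\sim$ and the binary connectives $\land,\lor,\to$. Abbreviate $\alpha\leftrightarrow\beta:=(\alpha\to\beta)\land(\beta\to\alpha)$. The logic $\mathbf{L}_{\mathrm{QN4}}$ is the consequence relation $\vdash_{\mathbf{L}_{\mathrm{QN4}}}$ given by the Hilbert calculus whose only rule is modus ponens ($\alpha,\alpha\to\beta\vdash\beta$) and whose axiom schemes are: Ax1 $\alpha\to(\beta\to\alpha)$; Ax2 $(\alpha\to(\beta\to\gamma))\to((\alpha\to\beta)\to(\alpha\to\gamma))$; Ax3 $(\alpha\land\beta)\to\alpha$; Ax4 $(\alpha\land\beta)\to\beta$; Ax5 $(\alpha\to\beta)\to((\alpha\to\gamma)\to(\alpha\to(\beta\land\gamma)))$; Ax6 $\alpha\to(\alpha\lor\beta)$; Ax7 $\beta\to(\alpha\lor\beta)$; Ax8 $(\alpha\to\gamma)\to((\beta\to\gamma)\to((\alpha\lor\beta)\to\gamma))$; Ax9 $\sim(\alpha\lor\beta)\leftrightarrow(\sim\alpha\land\sim\beta)$; Ax10 $\sim(\alpha\to\beta)\leftrightarrow\sim\sim(\alpha\land\sim\beta)$; Ax11 $\sim(\alpha\land(\beta\land\gamma))\leftrightarrow\sim((\alpha\land\beta)\land\gamma)$; Ax12 $\sim(\alpha\land(\beta\lor\gamma))\leftrightarrow\sim((\alpha\land\beta)\lor(\alpha\land\gamma))$; Ax13 $\sim(\alpha\lor(\beta\land\gamma))\leftrightarrow\sim((\alpha\lor\beta)\land(\alpha\lor\gamma))$;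 Ax14 $\sim\sim(\alpha\land\beta)\leftrightarrow(\sim\sim\alpha\land\sim\sim\beta)$; Ax15 $\alpha\to\sim\sim\alpha$; Ax16 $\alpha\to(\sim\alpha\to\sim(\alpha\to\alpha))$; Ax17 $(\alpha\to\beta)\to(\sim\sim\alpha\to\sim\sim\beta)$; Ax18 $\sim\alpha\to\sim(\alpha\land\beta)$; Ax19 $\sim(\alpha\land\beta)\to\sim(\beta\land\alpha)$; Ax20 $(\sim\alpha\to\sim\beta)\to(\sim(\alpha\land\beta)\to\sim\beta)$; Ax21 $(\sim\alpha\to\sim\beta)\to((\sim\gamma\to\sim\theta)\to(\sim(\alpha\land\gamma)\to\sim(\beta\land\theta)))$; Ax22 $\sim\sim\sim\alpha\to\sim\alpha$. For a set $\Delta(\alpha,\beta)$ of formulas and equation set $E$, $\Delta(E(\alpha))$ denotes $\Delta(\alpha,\alpha\to\alpha)$. A logic is algebraizable (Blok–Pigozzi) iff such $E$ and $\Delta$ exist satisfying reflexivity, symmetry, transitivity, $\alpha\dashv\vdash\Delta(E(\alpha))$ and the congruence condition; BP-algebraizable means additionally both $E$ and $\Delta$ are finite. -}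

module Defs where

open import Data.Nat using (ℕ)
open import Data.Sum using (_⊎_)
open import Data.Product using (_×_)
open import Relation.Binary.PropositionalEquality using (_≡_)

infixr 25 _⇒_
infixr 30 _∨_
infixr 35 _∧_

data Formula : Set where
  var : ℕ → Formula
  ~_  : Formula → Formula
  _∧_ : Formula → Formula → Formula
  _∨_ : Formula → Formula → Formula
  _⇒_ : Formula → Formula → Formula

_⇔_ : Formula → Formula → Formula
α ⇔ β = (α ⇒ β) ∧ (β ⇒ α)

data Axiom : Formula → Set where
  ax1  : ∀ α β → Axiom (α ⇒ (β ⇒ α))
  ax2  : ∀ α β γ → Axiom ((α ⇒ (β ⇒ γ)) ⇒ ((α ⇒ β) ⇒ (α ⇒ γ)))
  ax3  : ∀ α β → Axiom ((α ∧ β) ⇒ α)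
  ax4  : ∀ α β → Axiom ((α ∧ β) ⇒ β)
  ax5  : ∀ α β γ → Axiom ((α ⇒ β) ⇒ ((α ⇒ γ) ⇒ (α ⇒ (β ∧ γ))))
  ax6  : ∀ α β → Axiom (α ⇒ (α ∨ β))
  ax7  : ∀ α β → Axiom (β ⇒ (α ∨ β))
  ax8  : ∀ α β γ → Axiom ((α ⇒ γ) ⇒ ((β ⇒ γ) ⇒ ((α ∨ β) ⇒ γ)))
  ax9  : ∀ α β → Axiom ((~ (α ∨ β)) ⇔ ((~ α) ∧ (~ β)))
  ax10 : ∀ α β → Axiom ((~ (α ⇒ β)) ⇔ (~ (~ (α ∧ (~ β)))))
  ax11 : ∀ α β γ → Axiom ((~ (α ∧ (β ∧ γ))) ⇔ (~ ((α ∧ β) ∧ γ)))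
  ax12 : ∀ α β γ → Axiom ((~ (α ∧ (β ∨ γ))) ⇔ (~ ((α ∧ β) ∨ (α ∧ γ))))
  ax13 : ∀ α β γ → Axiom ((~ (α ∨ (β ∧ γ))) ⇔ (~ ((α ∨ β) ∧ (α ∨ γ))))
  ax14 : ∀ α β → Axiom ((~ (~ (α ∧ β))) ⇔ ((~ (~ α)) ∧ (~ (~ β))))
  ax15 : ∀ α → Axiom (α ⇒ (~ (~ α)))
  ax16 : ∀ α → Axiom (α ⇒ ((~ α) ⇒ (~ (α ⇒ α))))
  ax17 : ∀ α β → Axiom ((α ⇒ β) ⇒ ((~ (~ α)) ⇒ (~ (~ β))))
  ax18 : ∀ α β → Axiom ((~ α) ⇒ (~ (α ∧ β)))
  ax19 : ∀ α β → Axiom ((~ (α ∧ β)) ⇒ (~ (β ∧ α)))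
  ax20 : ∀ α β → Axiom (((~ α) ⇒ (~ β)) ⇒ ((~ (α ∧ β)) ⇒ (~ β)))
  ax21 : ∀ α β γ θ → Axiom (((~ α) ⇒ (~ β)) ⇒ (((~ γ) ⇒ (~ θ)) ⇒ ((~ (α ∧ γ)) ⇒ (~ (β ∧ θ)))))
  ax22 : ∀ α → Axiom ((~ (~ (~ α))) ⇒ (~ α))

FSet : Set₁
FSet = Formula → Set

_∪_ : FSet → FSet → FSet
(Γ ∪ Θ) φ = Γ φ ⊎ Θ φ

∅ : FSet
∅ _ = Data.Empty.⊥
  where import Data.Empty

⟦_⟧ : Formula → FSet
⟦ α ⟧ φ = φ ≡ α

data _⊢_ (Γ : FSet) : Formula → Set where
  hyp : ∀ {φ} → Γ φ → Γ ⊢ φ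
  axm : ∀ {φ} → Axiom φ → Γ ⊢ φ
  mp  : ∀ {φ ψ} → Γ ⊢ φ → Γ ⊢ (φ ⇒ ψ) → Γ ⊢ ψ

_⊢ˢ_ : FSet → FSet → Set
Γ ⊢ˢ Θ = ∀ φ → Θ φ → Γ ⊢ φ

data Δ (α β : Formula) : FSet where
  d1 : Δ α β (α ⇒ β)
  d2 : Δ α β (β ⇒ α)
  d3 : Δ α β ((~ α) ⇒ (~ β))
  d4 : Δ α β ((~ β) ⇒ (~ α))

-- Δ(E(α)) with E(α) = {α ≈ α → α}
ΔE : Formula → FSet
ΔE α = Δ α (α ⇒ α)

-- Δ(α, β) adds ∼α → ∼β and ∼β → ∼α to the two implications because strong
-- negation is not congruential for mere intuitionistic equivalence; with them,
-- every connective preserves Δ: for ∼ one uses Ax17 (∼∼ is monotone), for ∧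
-- Ax21, for ∨ Ax9 (∼ of a disjunction is a conjunction of ∼'s), and for →
-- Ax10 with Ax14, which make ∼(α → β) equivalent to ∼∼α ∧ ∼∼∼β.
-- The truth-equation α ≈ α → α is captured by Ax16 and by Ax22, the latter
-- turning ∼(α → α) into ∼α.
module Submission where

open import Defs
open import Data.Product using (_×_; _,_)
open import Data.Sum using (inj₁; inj₂)
open import Relation.Binary.PropositionalEquality using (refl)

private
  variable
    Γ Θ : FSet
    α β γ α₁ α₂ β₁ β₂ : Formula

infixl 5 _·_
_·_ : Γ ⊢ α ⇒ β → Γ ⊢ α → Γ ⊢ β
f · x = mp x f

⇒-const : Γ ⊢ β → Γ ⊢ α ⇒ β
⇒-const p = axm (ax1 _ _) · p

⇒-refl : Γ ⊢ α ⇒ α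
⇒-refl {α = α} = axm (ax2 α (α ⇒ α) α) · axm (ax1 α (α ⇒ α)) · axm (ax1 α α)

⇒-trans : Γ ⊢ α ⇒ β → Γ ⊢ β ⇒ γ → Γ ⊢ α ⇒ γ
⇒-trans f g = axm (ax2 _ _ _) · ⇒-const g · f

weaken : (∀ {φ} → Γ φ → Θ φ) → Γ ⊢ α → Θ ⊢ α
weaken Γ⊆Θ (hyp x)  = hyp (Γ⊆Θ x)
weaken Γ⊆Θ (axm a)  = axm a
weaken Γ⊆Θ (mp p q) = mp (weaken Γ⊆Θ p) (weaken Γ⊆Θ q)

deduction : (Γ ∪ ⟦ α ⟧) ⊢ β → Γ ⊢ α ⇒ β
deduction (hyp (inj₁ x))    = ⇒-const (hyp x)
deduction (hyp (inj₂ refl)) = ⇒-refl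
deduction (axm a)           = ⇒-const (axm a)
deduction (mp p q)          = axm (ax2 _ _ _) · deduction q · deduction p

∧-intro : Γ ⊢ α → Γ ⊢ β → Γ ⊢ α ∧ β
∧-intro {α = α} {β = β} p q = axm (ax5 α α β) · ⇒-refl · ⇒-const q · p

⇔-elimˡ : Γ ⊢ (α ⇔ β) → Γ ⊢ α ⇒ β
⇔-elimˡ p = axm (ax3 _ _) · p

⇔-elimʳ : Γ ⊢ (α ⇔ β) → Γ ⊢ β ⇒ α
⇔-elimʳ p = axm (ax4 _ _) · p

∧-map : Γ ⊢ α₁ ⇒ β₁ → Γ ⊢ α₂ ⇒ β₂ → Γ ⊢ (α₁ ∧ α₂) ⇒ (β₁ ∧ β₂)
∧-map f g = axm (ax5 _ _ _) · ⇒-trans (axm (ax3 _ _)) f · ⇒-trans (axm (ax4 _ _)) g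

∨-map : Γ ⊢ α₁ ⇒ β₁ → Γ ⊢ α₂ ⇒ β₂ → Γ ⊢ (α₁ ∨ α₂) ⇒ (β₁ ∨ β₂)
∨-map f g = axm (ax8 _ _ _) · ⇒-trans f (axm (ax6 _ _)) · ⇒-trans g (axm (ax7 _ _))

⇒-map : Γ ⊢ β₁ ⇒ α₁ → Γ ⊢ α₂ ⇒ β₂ → Γ ⊢ (α₁ ⇒ α₂) ⇒ (β₁ ⇒ β₂)
⇒-map f g = deduction (deduction (weaken′ g · (hyp (inj₁ (inj₂ refl)) · (weaken′ f · hyp (inj₂ refl)))))
  where
    weaken′ : ∀ {Γ α β φ} → Γ ⊢ φ → ((Γ ∪ ⟦ α ⟧) ∪ ⟦ β ⟧) ⊢ φ
    weaken′ = weaken (λ x → inj₁ (inj₁ x))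

~~-map : Γ ⊢ α ⇒ β → Γ ⊢ (~ (~ α)) ⇒ (~ (~ β))
~~-map f = axm (ax17 _ _) · f

~⇒-unfold : Γ ⊢ (~ (α ⇒ β)) ⇒ ((~ (~ α)) ∧ (~ (~ (~ β))))
~⇒-unfold {α = α} {β = β} = ⇒-trans (⇔-elimˡ (axm (ax10 α β))) (⇔-elimˡ (axm (ax14 α (~ β))))

~⇒-fold : Γ ⊢ ((~ (~ α)) ∧ (~ (~ (~ β)))) ⇒ (~ (α ⇒ β))
~⇒-fold {α = α} {β = β} = ⇒-trans (⇔-elimʳ (axm (ax14 α (~ β)))) (⇔-elimʳ (axm (ax10 α β)))

~⇒-elimʳ : Γ ⊢ (~ (α ⇒ β)) ⇒ (~ β)
~⇒-elimʳ = ⇒-trans ~⇒-unfold (⇒-trans (axm (ax4 _ _)) (axm (ax22 _)))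

~∧-map : Γ ⊢ (~ α₁) ⇒ (~ β₁) → Γ ⊢ (~ α₂) ⇒ (~ β₂) → Γ ⊢ (~ (α₁ ∧ α₂)) ⇒ (~ (β₁ ∧ β₂))
~∧-map f g = axm (ax21 _ _ _ _) · f · g

~∨-map : Γ ⊢ (~ α₁) ⇒ (~ β₁) → Γ ⊢ (~ α₂) ⇒ (~ β₂) → Γ ⊢ (~ (α₁ ∨ α₂)) ⇒ (~ (β₁ ∨ β₂))
~∨-map f g = ⇒-trans (⇔-elimˡ (axm (ax9 _ _))) (⇒-trans (∧-map f g) (⇔-elimʳ (axm (ax9 _ _))))

~⇒-map : Γ ⊢ α₁ ⇒ β₁ → Γ ⊢ (~ α₂) ⇒ (~ β₂) → Γ ⊢ (~ (α₁ ⇒ α₂)) ⇒ (~ (β₁ ⇒ β₂))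
~⇒-map f g = ⇒-trans ~⇒-unfold (⇒-trans (∧-map (~~-map f) (~~-map g)) ~⇒-fold)

Δˡ : ∀ {φ} → Δ α₁ β₁ φ → (Δ α₁ β₁ ∪ Δ α₂ β₂) ⊢ φ
Δˡ d = hyp (inj₁ d)

Δʳ : ∀ {φ} → Δ α₂ β₂ φ → (Δ α₁ β₁ ∪ Δ α₂ β₂) ⊢ φ
Δʳ d = hyp (inj₂ d)

Δ-refl : ∅ ⊢ˢ Δ α α
Δ-refl _ d1 = ⇒-refl
Δ-refl _ d2 = ⇒-refl
Δ-refl _ d3 = ⇒-refl
Δ-refl _ d4 = ⇒-refl

Δ-detach : (⟦ α ⟧ ∪ Δ α β) ⊢ β
Δ-detach = hyp (inj₂ d1) · hyp (inj₁ refl)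

Δ-sym : Δ α β ⊢ˢ Δ β α
Δ-sym _ d1 = hyp d2
Δ-sym _ d2 = hyp d1
Δ-sym _ d3 = hyp d4
Δ-sym _ d4 = hyp d3

Δ-trans : (Δ α β ∪ Δ β γ) ⊢ˢ Δ α γ
Δ-trans _ d1 = ⇒-trans (Δˡ d1) (Δʳ d1)
Δ-trans _ d2 = ⇒-trans (Δʳ d2) (Δˡ d2)
Δ-trans _ d3 = ⇒-trans (Δˡ d3) (Δʳ d3)
Δ-trans _ d4 = ⇒-trans (Δʳ d4) (Δˡ d4)

ΔE-intro : ⟦ α ⟧ ⊢ˢ ΔE α
ΔE-intro _ d1 = axm (ax1 _ _)
ΔE-intro _ d2 = ⇒-const (hyp refl)
ΔE-intro _ d3 = axm (ax16 _) · hyp refl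
ΔE-intro _ d4 = ~⇒-elimʳ

ΔE-elim : ΔE α ⊢ α
ΔE-elim = hyp d2 · ⇒-refl

Δ-cong-~ : Δ α β ⊢ˢ Δ (~ α) (~ β)
Δ-cong-~ _ d1 = hyp d3
Δ-cong-~ _ d2 = hyp d4
Δ-cong-~ _ d3 = ~~-map (hyp d1)
Δ-cong-~ _ d4 = ~~-map (hyp d2)

Δ-cong-∧ : (Δ α₁ β₁ ∪ Δ α₂ β₂) ⊢ˢ Δ (α₁ ∧ α₂) (β₁ ∧ β₂)
Δ-cong-∧ _ d1 = ∧-map (Δˡ d1) (Δʳ d1)
Δ-cong-∧ _ d2 = ∧-map (Δˡ d2) (Δʳ d2)
Δ-cong-∧ _ d3 = ~∧-map (Δˡ d3) (Δʳ d3)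
Δ-cong-∧ _ d4 = ~∧-map (Δˡ d4) (Δʳ d4)

Δ-cong-∨ : (Δ α₁ β₁ ∪ Δ α₂ β₂) ⊢ˢ Δ (α₁ ∨ α₂) (β₁ ∨ β₂)
Δ-cong-∨ _ d1 = ∨-map (Δˡ d1) (Δʳ d1)
Δ-cong-∨ _ d2 = ∨-map (Δˡ d2) (Δʳ d2)
Δ-cong-∨ _ d3 = ~∨-map (Δˡ d3) (Δʳ d3)
Δ-cong-∨ _ d4 = ~∨-map (Δˡ d4) (Δʳ d4)

Δ-cong-⇒ : (Δ α₁ β₁ ∪ Δ α₂ β₂) ⊢ˢ Δ (α₁ ⇒ α₂) (β₁ ⇒ β₂)
Δ-cong-⇒ _ d1 = ⇒-map (Δˡ d2) (Δʳ d1)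
Δ-cong-⇒ _ d2 = ⇒-map (Δˡ d1) (Δʳ d2)
Δ-cong-⇒ _ d3 = ~⇒-map (Δˡ d1) (Δʳ d3)
Δ-cong-⇒ _ d4 = ~⇒-map (Δˡ d2) (Δʳ d4)

theorem4 :
    (∀ α → ∅ ⊢ˢ Δ α α)
    × (∀ α β → (⟦ α ⟧ ∪ Δ α β) ⊢ β)
    × (∀ α β → Δ α β ⊢ˢ Δ β α)
    × (∀ α β γ → (Δ α β ∪ Δ β γ) ⊢ˢ Δ α γ)
    × (∀ α → ⟦ α ⟧ ⊢ˢ ΔE α)
    × (∀ α → ΔE α ⊢ α)
    × (∀ α β → Δ α β ⊢ˢ Δ (~ α) (~ β))
    × (∀ α₁ α₂ β₁ β₂ → (Δ α₁ β₁ ∪ Δ α₂ β₂) ⊢ˢ Δ (α₁ ∧ α₂) (β₁ ∧ β₂))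
    × (∀ α₁ α₂ β₁ β₂ → (Δ α₁ β₁ ∪ Δ α₂ β₂) ⊢ˢ Δ (α₁ ∨ α₂) (β₁ ∨ β₂))
    × (∀ α₁ α₂ β₁ β₂ → (Δ α₁ β₁ ∪ Δ α₂ β₂) ⊢ˢ Δ (α₁ ⇒ α₂) (β₁ ⇒ β₂))
theorem4 =
    (λ _ → Δ-refl)
  , (λ _ _ → Δ-detach)
  , (λ _ _ → Δ-sym)
  , (λ _ _ _ → Δ-trans)
  , (λ _ → ΔE-intro)
  , (λ _ → ΔE-elim)
  , (λ _ _ → Δ-cong-~)
  , (λ _ _ _ _ → Δ-cong-∧)
  , (λ _ _ _ _ → Δ-cong-∨)
  , (λ _ _ _ _ → Δ-cong-⇒)
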